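{- Let $G$ be a simple graph on $n$ vertices with adjacency matrix $A$ and walk-matrix $W=[e,Ae,\dots,A^{n-1}e]$ ($e$ the all-one vector), and assume $\det(W)\neq0$. Write $\det(W)=\epsilon\, 2^{\alpha}p_1^{\alpha_1}\cdots p_s^{\alpha_s}$ with $\epsilon=\pm1$ and $p_1,\dots,p_s$ distinct odd primes. Then $\alpha\geq\lfloor n/2\rfloor$. -}

module Defs where

open import Data.Nat as ℕ using (ℕ; zero; suc)
open import Data.Fin using (Fin; zero; suc; punchIn; toℕ)
open import Data.Bool using (Bool; true; false; if_then_else_)
open import Data.Integer as ℤ using (ℤ; +_; -_; _+_; _*_)
open import Data.Product using (_×_)
open import Relation.Binary.PropositionalEquality using (_≡_)

Matrix : ℕ → Set
Matrix n = Fin n → Fin n → ℤ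

∑ : ∀ {n} → (Fin n → ℤ) → ℤ
∑ {zero}  f = + 0
∑ {suc n} f = f zero + ∑ (λ i → f (suc i))

sign : ℕ → ℤ
sign zero          = + 1
sign (suc zero)    = - (+ 1)
sign (suc (suc k)) = sign k

det : ∀ {n} → Matrix n → ℤ
det {zero}  M = + 1
det {suc n} M =
  ∑ (λ j → sign (toℕ j) * (M zero j * det (λ r c → M (suc r) (punchIn j c))))

record SimpleGraph (n : ℕ) : Set where
  field
    adj       : Fin n → Fin n → Bool
    symmetric : ∀ i j → adj i j ≡ adj j i
    loopless  : ∀ i → adj i i ≡ false

adjMatrix : ∀ {n} → SimpleGraph n → Matrix n
adjMatrix G i j = if SimpleGraph.adj G i j then + 1 else + 0

mulVec : ∀ {n} → Matrix n → (Fin n → ℤ) → (Fin n → ℤ)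
mulVec M v i = ∑ (λ j → M i j * v j)

walkVec : ∀ {n} → Matrix n → ℕ → Fin n → ℤ
walkVec A zero    = λ _ → + 1
walkVec A (suc k) = mulVec A (walkVec A k)

walkMatrix : ∀ {n} → SimpleGraph n → Matrix n
walkMatrix G i j = walkVec (adjMatrix G) (toℕ j) i

-- The entries of the Gram matrix Wᵀ W are the walk counts e·A^(i+j) e, and e·Aᵏe is even for
-- k ≥ 1: for k = 2y+1 it is the quadratic form uᵀAu (u = Aʸe) of a symmetric matrix with zero
-- diagonal, and for k = 2y+2 it is u·u ≡ Σᵢ uᵢ = e·Aʸ⁺¹e (mod 2) with u = Aʸ⁺¹e, even by
-- induction. Hence every row of Wᵀ W but the first is even, so 2ⁿ⁻¹ divides
-- det (Wᵀ W) = (det W)² = 2^(2α) m², and as m is odd, n - 1 ≤ 2α.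
-- The product rule for the cofactor-expansion determinant comes from the uniqueness of
-- alternating multilinear forms: such a form is fixed on the row-selection matrices by its
-- value at the identity, since bubble-sorting the selection ends in a repeated row or in id.

module Submission where

open import Defs
open import Data.Nat as ℕ using (ℕ; zero; suc; z≤n; s≤s; _≤_)
import Data.Nat.Properties as ℕₚ
open import Data.Nat.Tactic.RingSolver renaming (solve-∀ to ℕ-solve-∀)
open import Data.Fin as Fin using (Fin; zero; suc; toℕ; punchIn; punchOut; inject₁)
import Data.Fin.Properties as Finₚ
open import Data.Product using (_,_)
open import Data.Sum using (_⊎_; inj₁; inj₂; reduce)
open import Function using (_∘_)
open import Relation.Nullary using (yes; no; contradiction)
open import Relation.Binary.PropositionalEquality

module BubbleSort where

  open import Data.Nat using (_+_; _*_; _<_; _∸_; _≤?_)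
  open ℕₚ.≤-Reasoning

  adjacentSwap : ∀ {m} → Fin m → Fin (suc m) → Fin (suc m)
  adjacentSwap zero    zero          = suc zero
  adjacentSwap zero    (suc zero)    = zero
  adjacentSwap zero    (suc (suc k)) = suc (suc k)
  adjacentSwap (suc j) zero          = zero
  adjacentSwap (suc j) (suc k)       = suc (adjacentSwap j k)

  sumℕ : ∀ {n} → (Fin n → ℕ) → ℕ
  sumℕ {zero}  g = 0
  sumℕ {suc n} g = g zero + sumℕ (g ∘ suc)

  sumℕ-mono-≤ : ∀ {n} {g h : Fin n → ℕ} → (∀ i → g i ≤ h i) → sumℕ g ≤ sumℕ h
  sumℕ-mono-≤ {zero}  g≤h = z≤n
  sumℕ-mono-≤ {suc n} g≤h = ℕₚ.+-mono-≤ (g≤h zero) (sumℕ-mono-≤ (g≤h ∘ suc))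

  rearrangement-< : ∀ {a b c d} → a < b → d < c → a * c + b * d < a * d + b * c
  rearrangement-< {a} {b} {c} {d} a<b d<c with ℕₚ.m≤n⇒∃[o]m+o≡n a<b | ℕₚ.m≤n⇒∃[o]m+o≡n d<c
  ... | x , refl | y , refl =
    subst (a * suc (d + y) + suc (a + x) * d <_) (gap a d x y) (ℕₚ.m<m+n _ (s≤s z≤n))
    where
    gap : ∀ a d x y → a * suc (d + y) + suc (a + x) * d + suc (x + y + x * y)
                      ≡ a * d + suc (a + x) * suc (d + y)
    gap = ℕ-solve-∀

  weightedSum : ∀ {m k} → (Fin m → ℕ) → (Fin m → Fin k) → ℕ
  weightedSum w σ = sumℕ (λ i → w i * toℕ (σ i))

  weightedSum-swap-< : ∀ {m k} (w : Fin (suc m) → ℕ) (σ : Fin (suc m) → Fin k) j →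
    w (inject₁ j) < w (suc j) → toℕ (σ (suc j)) < toℕ (σ (inject₁ j)) →
    weightedSum w σ < weightedSum w (σ ∘ adjacentSwap j)
  weightedSum-swap-< {suc m} w σ zero w< σ> = begin-strict
    w₀ * σ₀ + (w₁ * σ₁ + rest)  ≡⟨ ℕₚ.+-assoc (w₀ * σ₀) (w₁ * σ₁) rest ⟨
    w₀ * σ₀ + w₁ * σ₁ + rest    <⟨ ℕₚ.+-monoˡ-< rest (rearrangement-< w< σ>) ⟩
    w₀ * σ₁ + w₁ * σ₀ + rest    ≡⟨ ℕₚ.+-assoc (w₀ * σ₁) (w₁ * σ₀) rest ⟩
    w₀ * σ₁ + (w₁ * σ₀ + rest)  ∎
    where
    w₀ = w zero
    w₁ = w (suc zero)
    σ₀ = toℕ (σ zero)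
    σ₁ = toℕ (σ (suc zero))
    rest = sumℕ (λ i → w (suc (suc i)) * toℕ (σ (suc (suc i))))
  weightedSum-swap-< {suc m} w σ (suc j) w< σ> =
    ℕₚ.+-monoʳ-< (w zero * toℕ (σ zero)) (weightedSum-swap-< (w ∘ suc) (σ ∘ suc) j w< σ>)

  adjacentSwap-invariant : ∀ {m} {A : Set} (h : Fin (suc m) → A) j → h (inject₁ j) ≡ h (suc j) →
    ∀ r → h (adjacentSwap j r) ≡ h r
  adjacentSwap-invariant h zero    h≡ zero          = sym h≡
  adjacentSwap-invariant h zero    h≡ (suc zero)    = h≡
  adjacentSwap-invariant h zero    h≡ (suc (suc r)) = refl
  adjacentSwap-invariant h (suc j) h≡ zero          = refl
  adjacentSwap-invariant h (suc j) h≡ (suc r)       = adjacentSwap-invariant (h ∘ suc) j h≡ r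

  StrictlyIncreasing : ∀ {m} → (Fin (suc m) → ℕ) → Set
  StrictlyIncreasing {m} g = ∀ (j : Fin m) → g (inject₁ j) < g (suc j)

  increasing-lower : ∀ {m} (g : Fin (suc m) → ℕ) → StrictlyIncreasing g → ∀ i → g zero + toℕ i ≤ g i
  increasing-lower         g g↑ zero    = ℕₚ.≤-reflexive (ℕₚ.+-identityʳ (g zero))
  increasing-lower {suc m} g g↑ (suc i) = begin
    g zero + suc (toℕ i)  ≡⟨ ℕₚ.+-suc (g zero) (toℕ i) ⟩
    suc (g zero) + toℕ i  ≤⟨ ℕₚ.+-monoˡ-≤ (toℕ i) (g↑ zero) ⟩
    g (suc zero) + toℕ i  ≤⟨ increasing-lower (g ∘ suc) (g↑ ∘ suc) i ⟩
    g (suc i)             ∎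

  increasing-upper : ∀ {m} (g : Fin (suc m) → ℕ) → StrictlyIncreasing g →
    ∀ i → g i + (m ∸ toℕ i) ≤ g (Fin.fromℕ m)
  increasing-upper {m} g g↑ zero =
    subst (λ k → g zero + k ≤ g (Fin.fromℕ m)) (Finₚ.toℕ-fromℕ m) (increasing-lower g g↑ (Fin.fromℕ m))
  increasing-upper {suc m} g g↑ (suc i) = increasing-upper (g ∘ suc) (g↑ ∘ suc) i

  increasing⇒id : ∀ {m} (σ : Fin (suc m) → Fin (suc m)) → StrictlyIncreasing (toℕ ∘ σ) → ∀ i → σ i ≡ i
  increasing⇒id {m} σ σ↑ i = Finₚ.toℕ-injective (ℕₚ.≤-antisym σi≤i i≤σi)
    where
    i≤σi : toℕ i ≤ toℕ (σ i)
    i≤σi = ℕₚ.≤-trans (ℕₚ.m≤n+m (toℕ i) (toℕ (σ zero))) (increasing-lower (toℕ ∘ σ) σ↑ i)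
    σi≤i : toℕ (σ i) ≤ toℕ i
    σi≤i = ℕₚ.+-cancelʳ-≤ (m ∸ toℕ i) (toℕ (σ i)) (toℕ i) (begin
      toℕ (σ i) + (m ∸ toℕ i)  ≤⟨ increasing-upper (toℕ ∘ σ) σ↑ i ⟩
      toℕ (σ (Fin.fromℕ m))    ≤⟨ Finₚ.toℕ≤pred[n] (σ (Fin.fromℕ m)) ⟩
      m                        ≡⟨ ℕₚ.m+[n∸m]≡n (Finₚ.toℕ≤pred[n] i) ⟨
      toℕ i + (m ∸ toℕ i)      ∎)

  -- Bubble sort: swapping a descent strictly increases weightedSum toℕ, which is bounded.
  sort-induction : ∀ {m} (P : (Fin (suc m) → Fin (suc m)) → Set) →
    (∀ σ j → σ (inject₁ j) ≡ σ (suc j) → P σ) →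
    (∀ σ j → P (σ ∘ adjacentSwap j) → P σ) →
    (∀ σ → (∀ i → σ i ≡ i) → P σ) →
    ∀ σ → P σ
  sort-induction {m} P repeated swapped identity σ = go bound σ (ℕₚ.m≤n+m bound (score σ))
    where
    score : (Fin (suc m) → Fin (suc m)) → ℕ
    score = weightedSum toℕ
    bound : ℕ
    bound = sumℕ {suc m} (λ i → toℕ i * m)
    score≤bound : ∀ σ → score σ ≤ bound
    score≤bound σ = sumℕ-mono-≤ {suc m} (λ i → ℕₚ.*-monoʳ-≤ (toℕ i) (Finₚ.toℕ≤pred[n] (σ i)))
    go : ∀ fuel σ → bound ≤ score σ + fuel → P σ
    go fuel σ σ-bound with Finₚ.any? (λ j → toℕ (σ (suc j)) ≤? toℕ (σ (inject₁ j)))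
    ... | no no-descent = identity σ (increasing⇒id σ (λ j → ℕₚ.≰⇒> (no-descent ∘ (j ,_))))
    ... | yes (j , σ⇂) with ℕₚ.m≤n⇒m<n∨m≡n σ⇂
    ...   | inj₂ σ≡ = repeated σ j (Finₚ.toℕ-injective (sym σ≡))
    ...   | inj₁ σ> = swapped σ j (go-swapped fuel σ-bound)
      where
      increase : score σ < score (σ ∘ adjacentSwap j)
      increase = weightedSum-swap-< toℕ σ j (s≤s (ℕₚ.≤-reflexive (Finₚ.toℕ-inject₁ j))) σ>
      go-swapped : ∀ fuel → bound ≤ score σ + fuel → P (σ ∘ adjacentSwap j)
      go-swapped zero       σ-bound = contradiction (begin
        score (σ ∘ adjacentSwap j)  ≤⟨ score≤bound (σ ∘ adjacentSwap j) ⟩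
        bound                       ≤⟨ σ-bound ⟩
        score σ + 0                 ≡⟨ ℕₚ.+-identityʳ (score σ) ⟩
        score σ                     ∎) (ℕₚ.<⇒≱ increase)
      go-swapped (suc fuel) σ-bound = go fuel (σ ∘ adjacentSwap j) (begin
        bound                            ≤⟨ σ-bound ⟩
        score σ + suc fuel               ≡⟨ ℕₚ.+-suc (score σ) fuel ⟩
        suc (score σ) + fuel             ≤⟨ ℕₚ.+-monoˡ-≤ fuel increase ⟩
        score (σ ∘ adjacentSwap j) + fuel ∎)

open BubbleSort using (adjacentSwap; adjacentSwap-invariant; sort-induction)

module IntegerMatrices where

  open import Data.Integer as ℤ using (ℤ; +_; -_; _+_; _*_)
  open import Data.Integer.Properties
  open import Data.Integer.Tactic.RingSolver using (solve-∀)
  open import Data.Integer.Divisibility.Signed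
    using (_∣_; divides; ∣-refl; ∣-trans; ∣m∣n⇒∣m+n; ∣m+n∣n⇒∣m; ∣n⇒∣m*n; ∣m⇒∣m*n; *-monoʳ-∣; *-monoˡ-∣)
  open import Data.Integer.DivMod using (_%ℕ_; _/ℕ_; n%ℕd<d; a≡a%ℕn+[a/ℕn]*n)
  import Data.Nat.DivMod as ℕDivMod
  open import Data.Nat.Induction using (<-rec)
  open import Data.Bool using (if_then_else_)
  open import Data.Empty using (⊥-elim)
  open import Data.Vec.Functional using (Vector; updateAt; _∷_)
  open import Data.Vec.Functional.Properties using (map-updateAt-local; updateAt-id-local)
  open ≡-Reasoning

  ∑-cong : ∀ {n} {f g : Fin n → ℤ} → (∀ i → f i ≡ g i) → ∑ f ≡ ∑ g
  ∑-cong {zero}  f≗g = refl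
  ∑-cong {suc n} f≗g = cong₂ _+_ (f≗g zero) (∑-cong (f≗g ∘ suc))

  ∑-zero : ∀ n → ∑ {n} (λ _ → + 0) ≡ + 0
  ∑-zero zero    = refl
  ∑-zero (suc n) = trans (+-identityˡ _) (∑-zero n)

  ∑-distrib-+ : ∀ {n} (f g : Fin n → ℤ) → ∑ (λ i → f i + g i) ≡ ∑ f + ∑ g
  ∑-distrib-+ {zero}  f g = refl
  ∑-distrib-+ {suc n} f g = begin
    f zero + g zero + ∑ (λ i → f (suc i) + g (suc i))
      ≡⟨ cong (_+_ (f zero + g zero)) (∑-distrib-+ (f ∘ suc) (g ∘ suc)) ⟩
    f zero + g zero + (∑ (f ∘ suc) + ∑ (g ∘ suc))
      ≡⟨ +-interchange (f zero) (g zero) (∑ (f ∘ suc)) (∑ (g ∘ suc)) ⟩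
    f zero + ∑ (f ∘ suc) + (g zero + ∑ (g ∘ suc)) ∎
    where
    +-interchange : ∀ a b c d → a + b + (c + d) ≡ a + c + (b + d)
    +-interchange = solve-∀

  *-distribˡ-∑ : ∀ {n} (a : ℤ) (f : Fin n → ℤ) → a * ∑ f ≡ ∑ (λ i → a * f i)
  *-distribˡ-∑ {zero}  a f = *-zeroʳ a
  *-distribˡ-∑ {suc n} a f =
    trans (*-distribˡ-+ a (f zero) _) (cong (_+_ (a * f zero)) (*-distribˡ-∑ a (f ∘ suc)))

  *-distribʳ-∑ : ∀ {n} (a : ℤ) (f : Fin n → ℤ) → ∑ f * a ≡ ∑ (λ i → f i * a)
  *-distribʳ-∑ a f = trans (*-comm (∑ f) a) (trans (*-distribˡ-∑ a f) (∑-cong (λ i → *-comm a (f i))))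

  ∑-linear : ∀ {n} (a b : ℤ) (f g : Fin n → ℤ) → ∑ (λ i → a * f i + b * g i) ≡ a * ∑ f + b * ∑ g
  ∑-linear a b f g = trans (∑-distrib-+ (λ i → a * f i) (λ i → b * g i))
                           (sym (cong₂ _+_ (*-distribˡ-∑ a f) (*-distribˡ-∑ b g)))

  neg-distrib-∑ : ∀ {n} (f : Fin n → ℤ) → - ∑ f ≡ ∑ (λ i → - f i)
  neg-distrib-∑ f = begin
    - ∑ f                 ≡⟨ -1*i≡-i (∑ f) ⟨
    - + 1 * ∑ f           ≡⟨ *-distribˡ-∑ (- + 1) f ⟩
    ∑ (λ i → - + 1 * f i) ≡⟨ ∑-cong (λ i → -1*i≡-i (f i)) ⟩
    ∑ (λ i → - f i)       ∎

  ∑-comm : ∀ {m n} (f : Fin m → Fin n → ℤ) → ∑ (λ i → ∑ (f i)) ≡ ∑ (λ j → ∑ (λ i → f i j))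
  ∑-comm {zero}  {n} f = sym (∑-zero n)
  ∑-comm {suc m} {n} f = begin
    ∑ (f zero) + ∑ (λ i → ∑ (f (suc i)))
      ≡⟨ cong (_+_ (∑ (f zero))) (∑-comm (f ∘ suc)) ⟩
    ∑ (f zero) + ∑ (λ j → ∑ (λ i → f (suc i) j))
      ≡⟨ ∑-distrib-+ (f zero) _ ⟨
    ∑ (λ j → f zero j + ∑ (λ i → f (suc i) j)) ∎

  ∑-remove : ∀ {n} (a : Fin (suc n)) (f : Fin (suc n) → ℤ) → ∑ f ≡ f a + ∑ (f ∘ punchIn a)
  ∑-remove         zero    f = refl
  ∑-remove {suc n} (suc a) f = begin
    f zero + ∑ (f ∘ suc)                              ≡⟨ cong (_+_ (f zero)) (∑-remove a (f ∘ suc)) ⟩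
    f zero + (f (suc a) + ∑ (f ∘ suc ∘ punchIn a))    ≡⟨ +-left-comm (f zero) (f (suc a)) _ ⟩
    f (suc a) + (f zero + ∑ (f ∘ suc ∘ punchIn a))    ∎
    where
    +-left-comm : ∀ x y z → x + (y + z) ≡ y + (x + z)
    +-left-comm = solve-∀

  δ : ∀ {n} → Matrix n
  δ zero    zero    = + 1
  δ zero    (suc _) = + 0
  δ (suc _) zero    = + 0
  δ (suc i) (suc j) = δ i j

  δ-sym : ∀ {n} (i j : Fin n) → δ i j ≡ δ j i
  δ-sym zero    zero    = refl
  δ-sym zero    (suc j) = refl
  δ-sym (suc i) zero    = refl
  δ-sym (suc i) (suc j) = δ-sym i j

  ∑-δˡ : ∀ {n} (f : Fin n → ℤ) (i : Fin n) → ∑ (λ k → δ i k * f k) ≡ f i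
  ∑-δˡ {suc n} f zero = begin
    + 1 * f zero + ∑ (λ k → + 0 * f (suc k)) ≡⟨ cong₂ _+_ (*-identityˡ (f zero)) (∑-zero n) ⟩
    f zero + + 0                             ≡⟨ +-identityʳ (f zero) ⟩
    f zero                                   ∎
  ∑-δˡ {suc n} f (suc i) = trans (+-identityˡ _) (∑-δˡ (f ∘ suc) i)

  ∑-δʳ : ∀ {n} (f : Fin n → ℤ) (j : Fin n) → ∑ (λ k → f k * δ k j) ≡ f j
  ∑-δʳ f j = trans (∑-cong (λ k → trans (*-comm (f k) _) (cong (_* f k) (δ-sym k j)))) (∑-δˡ f j)

  sgn : ∀ {n} → Fin n → ℤ
  sgn j = sign (toℕ j)

  sign-suc : ∀ k → sign (suc k) ≡ - sign k
  sign-suc zero          = refl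
  sign-suc (suc zero)    = refl
  sign-suc (suc (suc k)) = sign-suc k

  minor : ∀ {n} → Matrix (suc n) → Fin (suc n) → Matrix n
  minor M j r c = M (suc r) (punchIn j c)

  det-cong : ∀ {n} {M N : Matrix n} → (∀ r c → M r c ≡ N r c) → det M ≡ det N
  det-cong {zero}  M≗N = refl
  det-cong {suc n} M≗N = ∑-cong (λ j →
    cong₂ (λ x y → sgn j * (x * y)) (M≗N zero j) (det-cong (λ r c → M≗N (suc r) (punchIn j c))))

  det-δ : ∀ n → det (δ {n}) ≡ + 1
  det-δ zero    = refl
  det-δ (suc n) = cong₂ _+_
    (trans (*-identityˡ _) (trans (*-identityˡ _) (det-δ n)))
    (trans (∑-cong {n} (λ j → *-zeroʳ (sgn (suc j)))) (∑-zero n))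

  infix 10 _ᵀ
  _ᵀ : ∀ {n} → Matrix n → Matrix n
  (M ᵀ) r c = M c r

  TransposeInvariant : ℕ → Set
  TransposeInvariant n = ∀ (M : Matrix n) → det (M ᵀ) ≡ det M

  doubleMinor : ∀ {n} → Matrix (suc (suc n)) → Fin (suc n) → Fin (suc n) → Matrix n
  doubleMinor M i j r c = M (suc (punchIn i r)) (suc (punchIn j c))

  crossTerm : ∀ {n} → Matrix (suc (suc n)) → Fin (suc n) → Fin (suc n) → ℤ
  crossTerm M i j = - (sgn i * sgn j) * (M (suc i) zero * M zero (suc j)) * det (doubleMinor M i j)

  -- Expanding the minors of the first row along their first column.
  det-first-row-tail : ∀ {n} → TransposeInvariant (suc n) → TransposeInvariant n →
    ∀ (M : Matrix (suc (suc n))) →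
    ∑ (λ j → sgn (suc j) * (M zero (suc j) * det (minor M (suc j)))) ≡ ∑ (λ j → ∑ (λ i → crossTerm M i j))
  det-first-row-tail transpose₁ transpose₀ M = ∑-cong expand
    where
    rearrange : ∀ s t a b d → - t * (a * (s * (b * d))) ≡ - (s * t) * (b * a) * d
    rearrange = solve-∀
    expand : ∀ j → sgn (suc j) * (M zero (suc j) * det (minor M (suc j))) ≡ ∑ (λ i → crossTerm M i j)
    expand j = begin
      sgn (suc j) * (M zero (suc j) * det (minor M (suc j)))
        ≡⟨ cong (λ x → sgn (suc j) * (M zero (suc j) * x)) (transpose₁ (minor M (suc j))) ⟨
      sgn (suc j) * (M zero (suc j) * ∑ (λ i → sgn i * (M (suc i) zero * det (doubleMinor M i j ᵀ))))
        ≡⟨ cong (λ x → sgn (suc j) * (M zero (suc j) * x))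
                (∑-cong (λ i → cong (λ x → sgn i * (M (suc i) zero * x)) (transpose₀ (doubleMinor M i j)))) ⟩
      sgn (suc j) * (M zero (suc j) * ∑ term)
        ≡⟨ cong (sgn (suc j) *_) (*-distribˡ-∑ (M zero (suc j)) term) ⟩
      sgn (suc j) * ∑ (λ i → M zero (suc j) * term i)
        ≡⟨ *-distribˡ-∑ (sgn (suc j)) (λ i → M zero (suc j) * term i) ⟩
      ∑ (λ i → sgn (suc j) * (M zero (suc j) * term i))
        ≡⟨ ∑-cong (λ i → trans (cong (_* (M zero (suc j) * term i)) (sign-suc (toℕ j)))
                               (rearrange (sgn i) (sgn j) (M zero (suc j)) (M (suc i) zero) _)) ⟩
      ∑ (λ i → crossTerm M i j) ∎
      where
      term : Fin (suc _) → ℤ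
      term i = sgn i * (M (suc i) zero * det (doubleMinor M i j))

  crossTerm-ᵀ : ∀ {n} → TransposeInvariant n → ∀ (M : Matrix (suc (suc n))) i j →
    crossTerm (M ᵀ) i j ≡ crossTerm M j i
  crossTerm-ᵀ transpose₀ M i j =
    cong₂ _*_ (swap-corner (sgn i) (sgn j) (M zero (suc i)) (M (suc j) zero)) (transpose₀ (doubleMinor M j i))
    where
    swap-corner : ∀ s t a b → - (s * t) * (a * b) ≡ - (t * s) * (b * a)
    swap-corner = solve-∀

  det-transpose-step : ∀ {n} → TransposeInvariant (suc n) → TransposeInvariant n →
    TransposeInvariant (suc (suc n))
  det-transpose-step transpose₁ transpose₀ M = cong₂ _+_
    (cong (λ x → + 1 * (M zero zero * x)) (transpose₁ (minor M zero)))
    (begin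
      ∑ (λ j → sgn (suc j) * (M (suc j) zero * det (minor (M ᵀ) (suc j))))
        ≡⟨ det-first-row-tail transpose₁ transpose₀ (M ᵀ) ⟩
      ∑ (λ j → ∑ (λ i → crossTerm (M ᵀ) i j))
        ≡⟨ ∑-cong (λ j → ∑-cong (λ i → crossTerm-ᵀ transpose₀ M i j)) ⟩
      ∑ (λ j → ∑ (λ i → crossTerm M j i))
        ≡⟨ ∑-comm (λ j i → crossTerm M j i) ⟩
      ∑ (λ i → ∑ (λ j → crossTerm M j i))
        ≡⟨ det-first-row-tail transpose₁ transpose₀ M ⟨
      ∑ (λ j → sgn (suc j) * (M zero (suc j) * det (minor M (suc j)))) ∎)

  det-transpose : ∀ n → TransposeInvariant n
  det-transpose zero          M = refl
  det-transpose (suc zero)    M = refl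
  det-transpose (suc (suc n))   = det-transpose-step (det-transpose (suc n)) (det-transpose n)

  Mat : ℕ → ℕ → Set
  Mat m n = Fin m → Fin n → ℤ

  _[_]≔_ : ∀ {A : Set} {n} → Vector A n → Fin n → A → Vector A n
  xs [ i ]≔ y = updateAt xs i (λ _ → y)

  ≔-congʳ : ∀ {m n} (X : Mat m n) i {u v : Fin n → ℤ} → (∀ c → u c ≡ v c) →
    ∀ r c → (X [ i ]≔ u) r c ≡ (X [ i ]≔ v) r c
  ≔-congʳ {suc m} X zero    u≗v zero    c = u≗v c
  ≔-congʳ {suc m} X zero    u≗v (suc r) c = refl
  ≔-congʳ {suc m} X (suc i) u≗v zero    c = refl
  ≔-congʳ {suc m} X (suc i) u≗v (suc r) c = ≔-congʳ (X ∘ suc) i u≗v r c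

  map-≔ : ∀ {A B : Set} {n} (φ : A → B) (xs : Vector A n) i y → ∀ r →
    φ ((xs [ i ]≔ y) r) ≡ ((φ ∘ xs) [ i ]≔ φ y) r
  map-≔ φ xs i y = map-updateAt-local {f = φ} xs i refl

  RowLinear : ∀ {m n} → (Mat m n → ℤ) → Set
  RowLinear {m} {n} f = ∀ X i a b (u v : Fin n → ℤ) →
    f (X [ i ]≔ (λ c → a * u c + b * v c)) ≡ a * f (X [ i ]≔ u) + b * f (X [ i ]≔ v)

  record IsMultilinear {m n} (f : Mat m n → ℤ) : Set where
    field
      cong-entries : ∀ {X Y} → (∀ r c → X r c ≡ Y r c) → f X ≡ f Y
      linear       : RowLinear f

  det-minor-≔ : ∀ {n} (X : Matrix (suc n)) i (w : Fin (suc n) → ℤ) j →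
    det (minor (X [ suc i ]≔ w) j) ≡ det (minor X j [ i ]≔ (w ∘ punchIn j))
  det-minor-≔ X i w j = det-cong (λ r c → cong (λ row → row c) (map-≔ (_∘ punchIn j) (X ∘ suc) i w r))

  det-linear : ∀ {n} → RowLinear (det {n})
  det-linear {suc n} X zero a b u v = begin
    ∑ (λ j → sgn j * ((a * u j + b * v j) * det (minor X j)))
      ≡⟨ ∑-cong (λ j → split (sgn j) a b (u j) (v j) (det (minor X j))) ⟩
    ∑ (λ j → a * term u j + b * term v j)
      ≡⟨ ∑-linear a b (term u) (term v) ⟩
    a * ∑ (term u) + b * ∑ (term v) ∎
    where
    term : (Fin (suc n) → ℤ) → Fin (suc n) → ℤ
    term y j = sgn j * (y j * det (minor X j))
    split : ∀ s a b x y d → s * ((a * x + b * y) * d) ≡ a * (s * (x * d)) + b * (s * (y * d))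
    split = solve-∀
  det-linear {suc n} X (suc i) a b u v = begin
    ∑ (λ j → sgn j * (X zero j * det (minor (X [ suc i ]≔ w) j)))
      ≡⟨ ∑-cong (λ j → cong (λ d → sgn j * (X zero j * d)) (trans (det-minor-≔ X i w j)
                              (det-linear (minor X j) i a b (u ∘ punchIn j) (v ∘ punchIn j)))) ⟩
    ∑ (λ j → sgn j * (X zero j * (a * minorDet u j + b * minorDet v j)))
      ≡⟨ ∑-cong (λ j → split (sgn j) (X zero j) a b (minorDet u j) (minorDet v j)) ⟩
    ∑ (λ j → a * term u j + b * term v j)
      ≡⟨ ∑-linear a b (term u) (term v) ⟩
    a * ∑ (term u) + b * ∑ (term v)
      ≡⟨ cong₂ (λ p q → a * p + b * q) (∑-cong (λ j → cong (λ d → sgn j * (X zero j * d)) (det-minor-≔ X i u j)))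
                                       (∑-cong (λ j → cong (λ d → sgn j * (X zero j * d)) (det-minor-≔ X i v j))) ⟨
    a * det (X [ suc i ]≔ u) + b * det (X [ suc i ]≔ v) ∎
    where
    w : Fin (suc n) → ℤ
    w c = a * u c + b * v c
    minorDet : (Fin (suc n) → ℤ) → Fin (suc n) → ℤ
    minorDet y j = det (minor X j [ i ]≔ (y ∘ punchIn j))
    term : (Fin (suc n) → ℤ) → Fin (suc n) → ℤ
    term y j = sgn j * (X zero j * minorDet y j)
    split : ∀ s x a b p q → s * (x * (a * p + b * q)) ≡ a * (s * (x * p)) + b * (s * (x * q))
    split = solve-∀

  det-isMultilinear : ∀ {n} → IsMultilinear (det {n})
  det-isMultilinear = record { cong-entries = det-cong ; linear = det-linear }

  -- The increasing enumeration of the complement of {a, b}.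
  punchIn₂ : ∀ {n} {a b : Fin (suc (suc n))} → a ≢ b → Fin n → Fin (suc (suc n))
  punchIn₂ {a = a} a≢b = punchIn a ∘ punchIn (punchOut a≢b)

  punchIn₂-sym : ∀ {n} {a b : Fin (suc (suc n))} (a≢b : a ≢ b) (b≢a : b ≢ a) c →
    punchIn₂ a≢b c ≡ punchIn₂ b≢a c
  punchIn₂-sym         {a = zero}  {zero}  a≢b b≢a c       = ⊥-elim (a≢b refl)
  punchIn₂-sym         {a = zero}  {suc b} a≢b b≢a c       = refl
  punchIn₂-sym         {a = suc a} {zero}  a≢b b≢a c       = refl
  punchIn₂-sym {suc n} {a = suc a} {suc b} a≢b b≢a zero    = refl
  punchIn₂-sym {suc n} {a = suc a} {suc b} a≢b b≢a (suc c) =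
    cong suc (punchIn₂-sym (a≢b ∘ cong suc) (b≢a ∘ cong suc) c)

  sgn-punchOut-antisym : ∀ {n} {a b : Fin (suc (suc n))} (a≢b : a ≢ b) (b≢a : b ≢ a) →
    sgn a * sgn (punchOut a≢b) ≡ - (sgn b * sgn (punchOut b≢a))
  sgn-punchOut-antisym {a = zero} {zero} a≢b b≢a = ⊥-elim (a≢b refl)
  sgn-punchOut-antisym {a = zero} {suc b} a≢b b≢a = begin
    + 1 * sgn b              ≡⟨ *-identityˡ (sgn b) ⟩
    sgn b                    ≡⟨ neg-involutive (sgn b) ⟨
    - - sgn b                ≡⟨ cong -_ (sign-suc (toℕ b)) ⟨
    - sgn (suc b)            ≡⟨ cong -_ (*-identityʳ (sgn (suc b))) ⟨
    - (sgn (suc b) * + 1)    ∎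
  sgn-punchOut-antisym {a = suc a} {zero} a≢b b≢a = begin
    sgn (suc a) * + 1        ≡⟨ *-identityʳ (sgn (suc a)) ⟩
    sgn (suc a)              ≡⟨ sign-suc (toℕ a) ⟩
    - sgn a                  ≡⟨ cong -_ (*-identityˡ (sgn a)) ⟨
    - (+ 1 * sgn a)          ∎
  sgn-punchOut-antisym {zero}  {a = suc zero} {suc zero} a≢b b≢a = ⊥-elim (a≢b refl)
  sgn-punchOut-antisym {suc n} {a = suc a}    {suc b}    a≢b b≢a = begin
    sgn (suc a) * sgn (suc (punchOut a≢b′))  ≡⟨ cong₂ _*_ (sign-suc (toℕ a)) (sign-suc (toℕ (punchOut a≢b′))) ⟩
    - sgn a * - sgn (punchOut a≢b′)          ≡⟨ neg-*-neg (sgn a) _ ⟩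
    sgn a * sgn (punchOut a≢b′)              ≡⟨ sgn-punchOut-antisym a≢b′ b≢a′ ⟩
    - (sgn b * sgn (punchOut b≢a′))          ≡⟨ cong -_ (neg-*-neg (sgn b) _) ⟨
    - (- sgn b * - sgn (punchOut b≢a′))
      ≡⟨ cong -_ (cong₂ _*_ (sign-suc (toℕ b)) (sign-suc (toℕ (punchOut b≢a′)))) ⟨
    - (sgn (suc b) * sgn (suc (punchOut b≢a′))) ∎
    where
    a≢b′ = a≢b ∘ cong suc
    b≢a′ = b≢a ∘ cong suc
    neg-*-neg : ∀ x y → - x * - y ≡ x * y
    neg-*-neg = solve-∀

  module _ {n} (M : Matrix (suc (suc n))) where

    private
      R : Fin (suc (suc n)) → Fin (suc n) → Matrix n
      R a k = minor (minor M a) k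

      -- The determinant of the matrix with rows p, q, M 2, M 3, …, expanded along its first two rows.
      D : (p q : Fin (suc (suc n)) → ℤ) → ℤ
      D p q = ∑ (λ a → sgn a * (p a * ∑ (λ k → sgn k * (q (punchIn a k) * det (R a k)))))

      -- D p q = Σ_{a,b} p a q b K a b, with K antisymmetric.
      K : Fin (suc (suc n)) → Fin (suc (suc n)) → ℤ
      K a b with a Fin.≟ b
      ... | yes _   = + 0
      ... | no  a≢b = sgn a * sgn (punchOut a≢b) * det (R a (punchOut a≢b))

      K-diagonal : ∀ a → K a a ≡ + 0
      K-diagonal a with a Fin.≟ a
      ... | yes _   = refl
      ... | no  a≢a = ⊥-elim (a≢a refl)

      K-punchIn : ∀ a k → K a (punchIn a k) ≡ sgn a * sgn k * det (R a k)
      K-punchIn a k with a Fin.≟ punchIn a k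
      ... | yes a≡ = ⊥-elim (Finₚ.punchInᵢ≢i a k (sym a≡))
      ... | no  a≢ = cong (λ k′ → sgn a * sgn k′ * det (R a k′))
                          (trans (Finₚ.punchOut-cong a refl) (Finₚ.punchOut-punchIn a))

      K-antisym : ∀ a b → K b a ≡ - K a b
      K-antisym a b with a Fin.≟ b | b Fin.≟ a
      ... | yes _   | yes _   = refl
      ... | yes a≡b | no  b≢a = ⊥-elim (b≢a (sym a≡b))
      ... | no  a≢b | yes b≡a = ⊥-elim (a≢b (sym b≡a))
      ... | no  a≢b | no  b≢a = begin
        sgn b * sgn (punchOut b≢a) * det (R b (punchOut b≢a))
          ≡⟨ cong₂ _*_ (sgn-punchOut-antisym b≢a a≢b)
                       (det-cong (λ r c → cong (M (suc (suc r))) (punchIn₂-sym b≢a a≢b c))) ⟩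
        - (sgn a * sgn (punchOut a≢b)) * det (R a (punchOut a≢b))
          ≡⟨ neg-distribˡ-* (sgn a * sgn (punchOut a≢b)) (det (R a (punchOut a≢b))) ⟨
        - (sgn a * sgn (punchOut a≢b) * det (R a (punchOut a≢b))) ∎

      D-bilinear : ∀ p q → D p q ≡ ∑ (λ a → ∑ (λ b → p a * (q b * K a b)))
      D-bilinear p q = ∑-cong row
        where
        rearrange : ∀ s t x y d → s * (x * (t * (y * d))) ≡ x * (y * (s * t * d))
        rearrange = solve-∀
        row : ∀ a → sgn a * (p a * ∑ (λ k → sgn k * (q (punchIn a k) * det (R a k))))
                  ≡ ∑ (λ b → p a * (q b * K a b))
        row a = begin
          sgn a * (p a * ∑ t)                 ≡⟨ cong (sgn a *_) (*-distribˡ-∑ (p a) t) ⟩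
          sgn a * ∑ (λ k → p a * t k)         ≡⟨ *-distribˡ-∑ (sgn a) (λ k → p a * t k) ⟩
          ∑ (λ k → sgn a * (p a * t k))       ≡⟨ ∑-cong move-K ⟩
          ∑ (pqK ∘ punchIn a)                 ≡⟨ +-identityˡ (∑ (pqK ∘ punchIn a)) ⟨
          + 0 + ∑ (pqK ∘ punchIn a)           ≡⟨ cong (_+ ∑ (pqK ∘ punchIn a)) pqK-diagonal ⟨
          pqK a + ∑ (pqK ∘ punchIn a)         ≡⟨ ∑-remove a pqK ⟨
          ∑ pqK                               ∎
          where
          t : Fin (suc n) → ℤ
          t k = sgn k * (q (punchIn a k) * det (R a k))
          pqK : Fin (suc (suc n)) → ℤ
          pqK b = p a * (q b * K a b)
          move-K : ∀ k → sgn a * (p a * t k) ≡ pqK (punchIn a k)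
          move-K k = trans (rearrange (sgn a) (sgn k) (p a) (q (punchIn a k)) (det (R a k)))
                           (cong (λ x → p a * (q (punchIn a k) * x)) (sym (K-punchIn a k)))
          pqK-diagonal : pqK a ≡ + 0
          pqK-diagonal = trans (cong (λ x → p a * (q a * x)) (K-diagonal a))
                               (trans (cong (p a *_) (*-zeroʳ (q a))) (*-zeroʳ (p a)))

      D-antisym : ∀ p q → D q p ≡ - D p q
      D-antisym p q = begin
        D q p                                        ≡⟨ D-bilinear q p ⟩
        ∑ (λ a → ∑ (λ b → q a * (p b * K a b)))     ≡⟨ ∑-comm (λ a b → q a * (p b * K a b)) ⟩
        ∑ (λ b → ∑ (λ a → q a * (p b * K a b)))     ≡⟨ ∑-cong (λ b → ∑-cong (λ a → flip b a)) ⟩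
        ∑ (λ b → ∑ (λ a → - T b a))                 ≡⟨ ∑-cong (λ b → neg-distrib-∑ (T b)) ⟨
        ∑ (λ b → - ∑ (T b))                         ≡⟨ neg-distrib-∑ (λ b → ∑ (T b)) ⟨
        - ∑ (λ b → ∑ (T b))                         ≡⟨ cong -_ (D-bilinear p q) ⟨
        - D p q                                      ∎
        where
        T : Fin (suc (suc n)) → Fin (suc (suc n)) → ℤ
        T b a = p b * (q a * K b a)
        pull-neg : ∀ x y k → x * (y * - k) ≡ - (y * (x * k))
        pull-neg = solve-∀
        flip : ∀ b a → q a * (p b * K a b) ≡ - T b a
        flip b a = trans (cong (λ k → q a * (p b * k)) (K-antisym b a)) (pull-neg (q a) (p b) (K b a))

    det-swap₀ : det (M ∘ adjacentSwap zero) ≡ - det M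
    det-swap₀ = D-antisym (M zero) (M (suc zero))

  det-swap : ∀ {n} (M : Matrix (suc n)) (j : Fin n) → det (M ∘ adjacentSwap j) ≡ - det M
  det-swap {suc n} M zero    = det-swap₀ M
  det-swap {suc n} M (suc j) = begin
    ∑ (λ k → sgn k * (M zero k * det (minor M k ∘ adjacentSwap j)))
      ≡⟨ ∑-cong (λ k → trans (cong (λ d → sgn k * (M zero k * d)) (det-swap (minor M k) j))
                             (pull-neg (sgn k) (M zero k) (det (minor M k)))) ⟩
    ∑ (λ k → - (sgn k * (M zero k * det (minor M k))))
      ≡⟨ neg-distrib-∑ (λ k → sgn k * (M zero k * det (minor M k))) ⟨
    - det M ∎
    where
    pull-neg : ∀ x y z → x * (y * - z) ≡ - (x * (y * z))
    pull-neg = solve-∀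

  IsAlternating : ∀ {m} → (Matrix (suc m) → ℤ) → Set
  IsAlternating f = ∀ X j → f (X ∘ adjacentSwap j) ≡ - f X

  ∑-maps : ∀ m {n} → ((Fin m → Fin n) → ℤ) → ℤ
  ∑-maps zero    h = h (λ ())
  ∑-maps (suc m) h = ∑ (λ k → ∑-maps m (λ τ → h (k ∷ τ)))

  ∑-maps-cong : ∀ m {n} {g h : (Fin m → Fin n) → ℤ} → (∀ σ → g σ ≡ h σ) → ∑-maps m g ≡ ∑-maps m h
  ∑-maps-cong zero    g≗h = g≗h _
  ∑-maps-cong (suc m) g≗h = ∑-cong (λ k → ∑-maps-cong m (λ τ → g≗h (k ∷ τ)))

  *-distribˡ-∑-maps : ∀ m {n} (a : ℤ) (h : (Fin m → Fin n) → ℤ) → a * ∑-maps m h ≡ ∑-maps m (λ σ → a * h σ)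
  *-distribˡ-∑-maps zero    a h = refl
  *-distribˡ-∑-maps (suc m) a h = trans (*-distribˡ-∑ a (λ k → ∑-maps m (λ τ → h (k ∷ τ))))
                                        (∑-cong (λ k → *-distribˡ-∑-maps m a (λ τ → h (k ∷ τ))))

  entryProduct : ∀ {m n} → Mat m n → (Fin m → Fin n) → ℤ
  entryProduct {zero}  X σ = + 1
  entryProduct {suc m} X σ = X zero (σ zero) * entryProduct (X ∘ suc) (σ ∘ suc)

  unitRows : ∀ {m n} → (Fin m → Fin n) → Mat m n
  unitRows σ i = δ (σ i)

  module _ {m n} {f : Mat m n → ℤ} (f-multilinear : IsMultilinear f) where
    open IsMultilinear f-multilinear

    ≔-zero : ∀ X i → f (X [ i ]≔ (λ _ → + 0)) ≡ + 0
    ≔-zero X i = linear X i (+ 0) (+ 0) (λ _ → + 0) (λ _ → + 0)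

    ≔-∑ : ∀ X i {p} (a : Fin p → ℤ) (w : Fin p → Fin n → ℤ) →
      f (X [ i ]≔ (λ c → ∑ (λ k → a k * w k c))) ≡ ∑ (λ k → a k * f (X [ i ]≔ w k))
    ≔-∑ X i {zero}  a w = ≔-zero X i
    ≔-∑ X i {suc p} a w = begin
      f (X [ i ]≔ (λ c → a zero * w zero c + rest c))
        ≡⟨ cong-entries (≔-congʳ X i (λ c → cong (_+_ (a zero * w zero c)) (sym (*-identityˡ (rest c))))) ⟩
      f (X [ i ]≔ (λ c → a zero * w zero c + + 1 * rest c))
        ≡⟨ linear X i (a zero) (+ 1) (w zero) rest ⟩
      a zero * f (X [ i ]≔ w zero) + + 1 * f (X [ i ]≔ rest)
        ≡⟨ cong (_+_ (a zero * f (X [ i ]≔ w zero)))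
                (trans (*-identityˡ (f (X [ i ]≔ rest))) (≔-∑ X i (a ∘ suc) (w ∘ suc))) ⟩
      a zero * f (X [ i ]≔ w zero) + ∑ (λ k → a (suc k) * f (X [ i ]≔ w (suc k))) ∎
      where
      rest : Fin n → ℤ
      rest c = ∑ (λ k → a (suc k) * w (suc k) c)

    expand-row : ∀ X i → f X ≡ ∑ (λ k → X i k * f (X [ i ]≔ δ k))
    expand-row X i = begin
      f X                                              ≡⟨ cong-entries X≗ ⟩
      f (X [ i ]≔ (λ c → ∑ (λ k → X i k * δ k c)))     ≡⟨ ≔-∑ X i (X i) δ ⟩
      ∑ (λ k → X i k * f (X [ i ]≔ δ k))               ∎
      where
      X≗ : ∀ r c → X r c ≡ (X [ i ]≔ (λ c → ∑ (λ k → X i k * δ k c))) r c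
      X≗ r c = trans (cong (λ row → row c) (sym (updateAt-id-local i X refl r)))
                     (≔-congʳ X i (λ c → sym (∑-δʳ (X i) c)) r c)

  fix-first-row : ∀ {m n} {f : Mat (suc m) n → ℤ} → IsMultilinear f → ∀ y → IsMultilinear (λ Y → f (y ∷ Y))
  fix-first-row {f = f} f-multilinear y = record
    { cong-entries = λ Y≗ → cong-entries (λ { zero c → refl ; (suc r) c → Y≗ r c })
    ; linear       = λ Y i a b u v → begin
        f (y ∷ (Y [ i ]≔ (λ c → a * u c + b * v c)))  ≡⟨ cong-entries (∷-≔ Y i _) ⟩
        f ((y ∷ Y) [ suc i ]≔ (λ c → a * u c + b * v c))
          ≡⟨ linear (y ∷ Y) (suc i) a b u v ⟩
        a * f ((y ∷ Y) [ suc i ]≔ u) + b * f ((y ∷ Y) [ suc i ]≔ v)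
          ≡⟨ cong₂ (λ p q → a * p + b * q) (cong-entries (∷-≔ Y i u)) (cong-entries (∷-≔ Y i v)) ⟨
        a * f (y ∷ (Y [ i ]≔ u)) + b * f (y ∷ (Y [ i ]≔ v)) ∎
    }
    where
    open IsMultilinear f-multilinear
    ∷-≔ : ∀ Y i w r c → (y ∷ (Y [ i ]≔ w)) r c ≡ ((y ∷ Y) [ suc i ]≔ w) r c
    ∷-≔ Y i w zero    c = refl
    ∷-≔ Y i w (suc r) c = refl

  multilinear-expansion : ∀ m {n} {f : Mat m n → ℤ} → IsMultilinear f → ∀ X →
    f X ≡ ∑-maps m (λ σ → entryProduct X σ * f (unitRows σ))
  multilinear-expansion zero f-multilinear X =
    trans (IsMultilinear.cong-entries f-multilinear (λ ())) (sym (*-identityˡ _))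
  multilinear-expansion (suc m) {f = f} f-multilinear X = begin
    f X
      ≡⟨ expand-row f-multilinear X zero ⟩
    ∑ (λ k → X zero k * f (X [ zero ]≔ δ k))
      ≡⟨ ∑-cong (λ k → cong (X zero k *_) (cong-entries (λ { zero c → refl ; (suc r) c → refl }))) ⟩
    ∑ (λ k → X zero k * f (δ k ∷ X ∘ suc))
      ≡⟨ ∑-cong (λ k → cong (X zero k *_)
                            (multilinear-expansion m (fix-first-row f-multilinear (δ k)) (X ∘ suc))) ⟩
    ∑ (λ k → X zero k * ∑-maps m (λ τ → entryProduct (X ∘ suc) τ * f (δ k ∷ unitRows τ)))
      ≡⟨ ∑-cong (λ k → *-distribˡ-∑-maps m (X zero k) (λ τ → entryProduct (X ∘ suc) τ * f (δ k ∷ unitRows τ))) ⟩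
    ∑ (λ k → ∑-maps m (λ τ → X zero k * (entryProduct (X ∘ suc) τ * f (δ k ∷ unitRows τ))))
      ≡⟨ ∑-cong (λ k → ∑-maps-cong m (λ τ →
           trans (sym (*-assoc (X zero k) (entryProduct (X ∘ suc) τ) _))
                 (cong (X zero k * entryProduct (X ∘ suc) τ *_)
                       (cong-entries (λ { zero c → refl ; (suc r) c → refl }))))) ⟩
    ∑-maps (suc m) (λ σ → entryProduct X σ * f (unitRows σ)) ∎
    where open IsMultilinear f-multilinear

  x≡-x⇒x≡0 : ∀ {x : ℤ} → x ≡ - x → x ≡ + 0
  x≡-x⇒x≡0 {+ zero} _ = refl

  module _ {m} {f : Matrix (suc m) → ℤ} (f-multilinear : IsMultilinear f) (f-alternating : IsAlternating f) where
    open IsMultilinear f-multilinear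

    alternating-equal-rows : ∀ X j → X (inject₁ j) ≡ X (suc j) → f X ≡ + 0
    alternating-equal-rows X j X≡ = x≡-x⇒x≡0 (begin
      f X                      ≡⟨ cong-entries (λ r c → cong (λ row → row c) (adjacentSwap-invariant X j X≡ r)) ⟨
      f (X ∘ adjacentSwap j)   ≡⟨ f-alternating X j ⟩
      - f X                    ∎)

  module _ {m} {f g : Matrix (suc m) → ℤ}
           (f-multilinear : IsMultilinear f) (f-alternating : IsAlternating f)
           (g-multilinear : IsMultilinear g) (g-alternating : IsAlternating g) where

    alternating-proportional-on-unitRows : ∀ σ → f (unitRows σ) * g δ ≡ g (unitRows σ) * f δ
    alternating-proportional-on-unitRows = sort-induction _ repeated swapped identity
      where
      repeated : ∀ σ j → σ (inject₁ j) ≡ σ (suc j) → f (unitRows σ) * g δ ≡ g (unitRows σ) * f δ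
      repeated σ j σ≡ = begin
        f (unitRows σ) * g δ  ≡⟨ cong (_* g δ) (alternating-equal-rows f-multilinear f-alternating _ j δσ≡) ⟩
        + 0 * g δ             ≡⟨⟩
        + 0 * f δ             ≡⟨ cong (_* f δ) (alternating-equal-rows g-multilinear g-alternating _ j δσ≡) ⟨
        g (unitRows σ) * f δ  ∎
        where δσ≡ = cong δ σ≡
      swapped : ∀ σ j → f (unitRows (σ ∘ adjacentSwap j)) * g δ ≡ g (unitRows (σ ∘ adjacentSwap j)) * f δ →
                        f (unitRows σ) * g δ ≡ g (unitRows σ) * f δ
      swapped σ j eq = neg-injective (begin
        - (f (unitRows σ) * g δ)                  ≡⟨ neg-distribˡ-* (f (unitRows σ)) (g δ) ⟩
        - f (unitRows σ) * g δ                    ≡⟨ cong (_* g δ) (f-alternating (unitRows σ) j) ⟨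
        f (unitRows (σ ∘ adjacentSwap j)) * g δ   ≡⟨ eq ⟩
        g (unitRows (σ ∘ adjacentSwap j)) * f δ   ≡⟨ cong (_* f δ) (g-alternating (unitRows σ) j) ⟩
        - g (unitRows σ) * f δ                    ≡⟨ neg-distribˡ-* (g (unitRows σ)) (f δ) ⟨
        - (g (unitRows σ) * f δ)                  ∎)
      identity : ∀ σ → (∀ i → σ i ≡ i) → f (unitRows σ) * g δ ≡ g (unitRows σ) * f δ
      identity σ σ≗id = begin
        f (unitRows σ) * g δ  ≡⟨ cong (_* g δ) (IsMultilinear.cong-entries f-multilinear unitRows≗δ) ⟨
        f δ * g δ             ≡⟨ *-comm (f δ) (g δ) ⟩
        g δ * f δ             ≡⟨ cong (_* f δ) (IsMultilinear.cong-entries g-multilinear unitRows≗δ) ⟩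
        g (unitRows σ) * f δ  ∎
        where
        unitRows≗δ : ∀ r c → δ r c ≡ unitRows σ r c
        unitRows≗δ r c = cong (λ i → δ i c) (sym (σ≗id r))

  alternating-multilinear-unique : ∀ {m} {f : Matrix (suc m) → ℤ} → IsMultilinear f → IsAlternating f →
    ∀ X → f X ≡ det X * f δ
  alternating-multilinear-unique {m} {f} f-multilinear f-alternating X = begin
    f X
      ≡⟨ multilinear-expansion (suc m) f-multilinear X ⟩
    ∑-maps (suc m) (λ σ → entryProduct X σ * f (unitRows σ))
      ≡⟨ ∑-maps-cong (suc m) (λ σ → cong (entryProduct X σ *_) (on-unitRows σ)) ⟩
    ∑-maps (suc m) (λ σ → entryProduct X σ * (det (unitRows σ) * f δ))
      ≡⟨ ∑-maps-cong (suc m) (λ σ → reorder (entryProduct X σ) (det (unitRows σ)) (f δ)) ⟩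
    ∑-maps (suc m) (λ σ → f δ * (entryProduct X σ * det (unitRows σ)))
      ≡⟨ *-distribˡ-∑-maps (suc m) (f δ) (λ σ → entryProduct X σ * det (unitRows σ)) ⟨
    f δ * ∑-maps (suc m) (λ σ → entryProduct X σ * det (unitRows σ))
      ≡⟨ cong (f δ *_) (multilinear-expansion (suc m) det-isMultilinear X) ⟨
    f δ * det X
      ≡⟨ *-comm (f δ) (det X) ⟩
    det X * f δ ∎
    where
    reorder : ∀ p d c → p * (d * c) ≡ c * (p * d)
    reorder = solve-∀
    on-unitRows : ∀ σ → f (unitRows σ) ≡ det (unitRows σ) * f δ
    on-unitRows σ = begin
      f (unitRows σ)                   ≡⟨ *-identityʳ (f (unitRows σ)) ⟨
      f (unitRows σ) * + 1             ≡⟨ cong (f (unitRows σ) *_) (det-δ (suc m)) ⟨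
      f (unitRows σ) * det (δ {suc m}) ≡⟨ alternating-proportional-on-unitRows f-multilinear f-alternating
                                                                          det-isMultilinear det-swap σ ⟩
      det (unitRows σ) * f δ           ∎

  infixl 7 _*ᴹ_
  _*ᴹ_ : ∀ {n} → Matrix n → Matrix n → Matrix n
  (X *ᴹ Y) r c = ∑ (λ k → X r k * Y k c)

  det-*ᴹ : ∀ {n} (X Y : Matrix n) → det (X *ᴹ Y) ≡ det X * det Y
  det-*ᴹ {zero}  X Y = refl
  det-*ᴹ {suc m} X Y = begin
    det (X *ᴹ Y)          ≡⟨ alternating-multilinear-unique *ᴹY-multilinear (λ Z → det-swap (Z *ᴹ Y)) X ⟩
    det X * det (δ *ᴹ Y)  ≡⟨ cong (det X *_) (det-cong (λ r c → ∑-δˡ (λ k → Y k c) r)) ⟩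
    det X * det Y         ∎
    where
    _*Y : (Fin (suc m) → ℤ) → Fin (suc m) → ℤ
    (w *Y) c = ∑ (λ k → w k * Y k c)
    *Y-linear : ∀ a b u v c → ((λ k → a * u k + b * v k) *Y) c ≡ a * (u *Y) c + b * (v *Y) c
    *Y-linear a b u v c = begin
      ∑ (λ k → (a * u k + b * v k) * Y k c)
        ≡⟨ ∑-cong (λ k → distribute a b (u k) (v k) (Y k c)) ⟩
      ∑ (λ k → a * (u k * Y k c) + b * (v k * Y k c))
        ≡⟨ ∑-linear a b (λ k → u k * Y k c) (λ k → v k * Y k c) ⟩
      a * (u *Y) c + b * (v *Y) c ∎
      where
      distribute : ∀ a b x y z → (a * x + b * y) * z ≡ a * (x * z) + b * (y * z)
      distribute = solve-∀
    ≔-*ᴹ : ∀ Z i w r c → ((Z [ i ]≔ w) *ᴹ Y) r c ≡ ((Z *ᴹ Y) [ i ]≔ (w *Y)) r c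
    ≔-*ᴹ Z i w r c = cong (λ row → row c) (map-≔ _*Y Z i w r)
    *ᴹY-cong : ∀ {Z Z′} → (∀ r c → Z r c ≡ Z′ r c) → det (Z *ᴹ Y) ≡ det (Z′ *ᴹ Y)
    *ᴹY-cong Z≗ = det-cong (λ r c → ∑-cong (λ k → cong (_* Y k c) (Z≗ r k)))
    *ᴹY-linear : RowLinear (λ Z → det (Z *ᴹ Y))
    *ᴹY-linear Z i a b u v = begin
      det ((Z [ i ]≔ (λ c → a * u c + b * v c)) *ᴹ Y)
        ≡⟨ det-cong (≔-*ᴹ Z i (λ c → a * u c + b * v c)) ⟩
      det ((Z *ᴹ Y) [ i ]≔ ((λ c → a * u c + b * v c) *Y))
        ≡⟨ det-cong (≔-congʳ (Z *ᴹ Y) i (*Y-linear a b u v)) ⟩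
      det ((Z *ᴹ Y) [ i ]≔ (λ c → a * (u *Y) c + b * (v *Y) c))
        ≡⟨ det-linear (Z *ᴹ Y) i a b (u *Y) (v *Y) ⟩
      a * det ((Z *ᴹ Y) [ i ]≔ (u *Y)) + b * det ((Z *ᴹ Y) [ i ]≔ (v *Y))
        ≡⟨ cong₂ (λ p q → a * p + b * q) (det-cong (≔-*ᴹ Z i u)) (det-cong (≔-*ᴹ Z i v)) ⟨
      a * det ((Z [ i ]≔ u) *ᴹ Y) + b * det ((Z [ i ]≔ v) *ᴹ Y) ∎
    *ᴹY-multilinear : IsMultilinear (λ Z → det (Z *ᴹ Y))
    *ᴹY-multilinear = record { cong-entries = *ᴹY-cong ; linear = *ᴹY-linear }

  ∑-∣ : ∀ {n} {k : ℤ} (f : Fin n → ℤ) → (∀ i → k ∣ f i) → k ∣ ∑ f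
  ∑-∣ {zero}  f k∣f = divides (+ 0) refl
  ∑-∣ {suc n} f k∣f = ∣m∣n⇒∣m+n (k∣f zero) (∑-∣ (f ∘ suc) (k∣f ∘ suc))

  *-pres-∣ : ∀ {i j a b : ℤ} → i ∣ a → j ∣ b → i * j ∣ a * b
  *-pres-∣ {i} {j} {a} {b} i∣a j∣b = ∣-trans (*-monoˡ-∣ j i∣a) (*-monoʳ-∣ a j∣b)

  det-divisible : ∀ {n} {k : ℤ} (M : Matrix n) → (∀ r c → k ∣ M r c) → k ℤ.^ n ∣ det M
  det-divisible {zero}  M k∣M = ∣-refl
  det-divisible {suc n} M k∣M = ∑-∣ _ (λ j → ∣n⇒∣m*n (sgn j)
    (*-pres-∣ (k∣M zero j) (det-divisible (minor M j) (λ r c → k∣M (suc r) (punchIn j c)))))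

  det-divisible-tail : ∀ {n} {k : ℤ} (M : Matrix (suc n)) → (∀ r c → k ∣ M (suc r) c) → k ℤ.^ n ∣ det M
  det-divisible-tail M k∣M = ∑-∣ _ (λ j → ∣n⇒∣m*n (sgn j)
    (∣n⇒∣m*n (M zero j) (det-divisible (minor M j) (λ r c → k∣M r (punchIn j c)))))

  x*[x+1]-even : ∀ x → + 2 ∣ x * (x + + 1)
  x*[x+1]-even x with x %ℕ 2 | n%ℕd<d x 2 | a≡a%ℕn+[a/ℕn]*n x 2
  ... | zero        | _             | x≡ = ∣m⇒∣m*n (x + + 1) (divides (x /ℕ 2) (trans x≡ (+-identityˡ _)))
  ... | suc zero    | _             | x≡ =
    ∣n⇒∣m*n x (divides (x /ℕ 2 + + 1) (trans (cong (_+ + 1) x≡) (odd+1 (x /ℕ 2))))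
    where
    odd+1 : ∀ q → + 1 + q * + 2 + + 1 ≡ (q + + 1) * + 2
    odd+1 = solve-∀
  ... | suc (suc _) | s≤s (s≤s ()) | _

  ∑∑-symmetric-hollow-even : ∀ {n} (q : Matrix n) → (∀ i j → q i j ≡ q j i) → (∀ i → q i i ≡ + 0) →
    + 2 ∣ ∑ (λ i → ∑ (q i))
  ∑∑-symmetric-hollow-even {zero}  q q-sym q-hollow = divides (+ 0) refl
  ∑∑-symmetric-hollow-even {suc n} q q-sym q-hollow =
    subst (+ 2 ∣_) (sym split) (∣m∣n⇒∣m+n (divides S refl)
      (∑∑-symmetric-hollow-even (λ i j → q (suc i) (suc j)) (λ i j → q-sym (suc i) (suc j)) (q-hollow ∘ suc)))
    where
    S = ∑ (λ j → q zero (suc j))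
    R = ∑ (λ i → ∑ (λ j → q (suc i) (suc j)))
    regroup : ∀ S R → + 0 + S + (S + R) ≡ S * + 2 + R
    regroup = solve-∀
    split : q zero zero + S + ∑ (λ i → q (suc i) zero + ∑ (λ j → q (suc i) (suc j))) ≡ S * + 2 + R
    split = begin
      q zero zero + S + ∑ (λ i → q (suc i) zero + ∑ (λ j → q (suc i) (suc j)))
        ≡⟨ cong₂ _+_ (cong (_+ S) (q-hollow zero))
                     (∑-distrib-+ (λ i → q (suc i) zero) (λ i → ∑ (λ j → q (suc i) (suc j)))) ⟩
      + 0 + S + (∑ (λ i → q (suc i) zero) + R)
        ≡⟨ cong (λ T → + 0 + S + (T + R)) (∑-cong (λ i → q-sym (suc i) zero)) ⟩
      + 0 + S + (S + R)
        ≡⟨ regroup S R ⟩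
      S * + 2 + R ∎

  dot : ∀ {n} → (Fin n → ℤ) → (Fin n → ℤ) → ℤ
  dot u w = ∑ (λ i → u i * w i)

  dot-self-parity : ∀ {n} (u : Fin n → ℤ) → + 2 ∣ dot u u + ∑ u
  dot-self-parity u = subst (+ 2 ∣_) factor (∑-∣ (λ i → u i * (u i + + 1)) (λ i → x*[x+1]-even (u i)))
    where
    factor : ∑ (λ i → u i * (u i + + 1)) ≡ dot u u + ∑ u
    factor = trans (∑-cong (λ i → trans (*-distribˡ-+ (u i) (u i) (+ 1))
                                        (cong (_+_ (u i * u i)) (*-identityʳ (u i)))))
                   (∑-distrib-+ (λ i → u i * u i) u)

  module _ {n} {M : Matrix n} (M-sym : ∀ i j → M i j ≡ M j i) where

    mulVec-self-adjoint : ∀ u w → dot (mulVec M u) w ≡ dot u (mulVec M w)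
    mulVec-self-adjoint u w = begin
      ∑ (λ i → ∑ (λ j → M i j * u j) * w i)
        ≡⟨ ∑-cong (λ i → *-distribʳ-∑ (w i) (λ j → M i j * u j)) ⟩
      ∑ (λ i → ∑ (λ j → M i j * u j * w i))
        ≡⟨ ∑-comm (λ i j → M i j * u j * w i) ⟩
      ∑ (λ j → ∑ (λ i → M i j * u j * w i))
        ≡⟨ ∑-cong (λ j → ∑-cong (λ i → trans (cong (λ x → x * u j * w i) (M-sym i j))
                                             (reorder (M j i) (u j) (w i)))) ⟩
      ∑ (λ j → ∑ (λ i → u j * (M j i * w i)))
        ≡⟨ ∑-cong (λ j → *-distribˡ-∑ (u j) (λ i → M j i * w i)) ⟨
      ∑ (λ j → u j * ∑ (λ i → M j i * w i)) ∎
      where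
      reorder : ∀ a b c → a * b * c ≡ b * (a * c)
      reorder = solve-∀

    walkVec-dot : ∀ i j → dot (walkVec M i) (walkVec M j) ≡ ∑ (walkVec M (i ℕ.+ j))
    walkVec-dot zero    j = ∑-cong (λ k → *-identityˡ (walkVec M j k))
    walkVec-dot (suc i) j = begin
      dot (mulVec M (walkVec M i)) (walkVec M j)   ≡⟨ mulVec-self-adjoint (walkVec M i) (walkVec M j) ⟩
      dot (walkVec M i) (walkVec M (suc j))         ≡⟨ walkVec-dot i (suc j) ⟩
      ∑ (walkVec M (i ℕ.+ suc j))                   ≡⟨ cong (∑ ∘ walkVec M) (ℕₚ.+-suc i j) ⟩
      ∑ (walkVec M (suc i ℕ.+ j))                   ∎

    module _ (M-hollow : ∀ i → M i i ≡ + 0) where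

      walkVec-sum-even : ∀ k → + 2 ∣ ∑ (walkVec M (suc k))
      walkVec-sum-even = <-rec _ step
        where
        step : ∀ k → (∀ {y} → y ℕ.< k → + 2 ∣ ∑ (walkVec M (suc y))) → + 2 ∣ ∑ (walkVec M (suc k))
        step k rec with k ℕ.% 2 | ℕDivMod.m%n<n k 2 | ℕDivMod.m≡m%n+[m/n]*n k 2
        ... | zero        | _             | k≡ = subst (+ 2 ∣_) quadratic-form
          (∑∑-symmetric-hollow-even (λ i j → u i * (M i j * u j))
            (λ i j → trans (cong (λ x → u i * (x * u j)) (M-sym i j)) (swap-ends (u i) (M j i) (u j)))
            (λ i → trans (cong (λ x → u i * (x * u i)) (M-hollow i)) (*-zeroʳ (u i))))
          where
          y = k ℕ./ 2
          u = walkVec M y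
          swap-ends : ∀ a b c → a * (b * c) ≡ c * (b * a)
          swap-ends = solve-∀
          y+[1+y] : ∀ y → y ℕ.+ suc y ≡ suc (y ℕ.* 2)
          y+[1+y] = ℕ-solve-∀
          quadratic-form : ∑ (λ i → ∑ (λ j → u i * (M i j * u j))) ≡ ∑ (walkVec M (suc k))
          quadratic-form = begin
            ∑ (λ i → ∑ (λ j → u i * (M i j * u j)))   ≡⟨ ∑-cong (λ i → *-distribˡ-∑ (u i) (λ j → M i j * u j)) ⟨
            dot u (walkVec M (suc y))                  ≡⟨ walkVec-dot y (suc y) ⟩
            ∑ (walkVec M (y ℕ.+ suc y))
              ≡⟨ cong (∑ ∘ walkVec M) (trans (y+[1+y] y) (cong suc (sym k≡))) ⟩
            ∑ (walkVec M (suc k))                      ∎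
        ... | suc zero    | _             | k≡ = subst (+ 2 ∣_) square
          (∣m+n∣n⇒∣m (dot-self-parity w) (rec y<k))
          where
          y = k ℕ./ 2
          w = walkVec M (suc y)
          [1+y]+[1+y] : ∀ y → suc y ℕ.+ suc y ≡ suc (1 ℕ.+ y ℕ.* 2)
          [1+y]+[1+y] = ℕ-solve-∀
          y<k : y ℕ.< k
          y<k = subst (y ℕ.<_) (sym k≡) (s≤s (ℕₚ.m≤m*n y 2))
          square : dot w w ≡ ∑ (walkVec M (suc k))
          square = trans (walkVec-dot (suc y) (suc y))
                         (cong (∑ ∘ walkVec M) (trans ([1+y]+[1+y] y) (cong suc (sym k≡))))
        ... | suc (suc _) | s≤s (s≤s ()) | _

  adjMatrix-symmetric : ∀ {n} (G : SimpleGraph n) i j → adjMatrix G i j ≡ adjMatrix G j i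
  adjMatrix-symmetric G i j = cong (λ b → if b then + 1 else + 0) (SimpleGraph.symmetric G i j)

  adjMatrix-hollow : ∀ {n} (G : SimpleGraph n) i → adjMatrix G i i ≡ + 0
  adjMatrix-hollow G i = cong (λ b → if b then + 1 else + 0) (SimpleGraph.loopless G i)

  walkMatrix-det²-divisible : ∀ {n} (G : SimpleGraph (suc n)) →
    (+ 2) ℤ.^ n ∣ det (walkMatrix G) * det (walkMatrix G)
  walkMatrix-det²-divisible {n} G = subst ((+ 2) ℤ.^ n ∣_) det-gram
    (det-divisible-tail (W ᵀ *ᴹ W) (λ r c →
      subst (+ 2 ∣_) (sym (walkVec-dot A-sym (suc (toℕ r)) (toℕ c)))
            (walkVec-sum-even A-sym (adjMatrix-hollow G) (toℕ r ℕ.+ toℕ c))))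
    where
    W = walkMatrix G
    A-sym = adjMatrix-symmetric G
    det-gram : det (W ᵀ *ᴹ W) ≡ det W * det W
    det-gram = trans (det-*ᴹ (W ᵀ) W) (cong (_* det W) (det-transpose (suc n) W))

  pos-^ : ∀ a k → (+ a) ℤ.^ k ≡ + (a ℕ.^ k)
  pos-^ a zero    = refl
  pos-^ a (suc k) = trans (cong (+ a *_) (pos-^ a k)) (sym (pos-* a (a ℕ.^ k)))

  ±-square : ∀ {x} P → x ≡ + P ⊎ x ≡ - + P → x * x ≡ + (P ℕ.* P)
  ±-square P (inj₁ refl) = sym (pos-* P P)
  ±-square P (inj₂ refl) = trans (neg-*-neg (+ P)) (sym (pos-* P P))
    where
    neg-*-neg : ∀ x → - x * - x ≡ x * x
    neg-*-neg = solve-∀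

open IntegerMatrices using (walkMatrix-det²-divisible; pos-^; ±-square)
open import Data.Nat using (_+_; _*_; _^_; _/_)
open import Data.Nat.DivMod using (m<n*o⇒m/o<n)
open import Data.Nat.Divisibility using (_∣_; _∤_; ∣-trans; m∣m*n; *-cancelˡ-∣)
open import Data.Nat.Primality using (euclidsLemma; prime[2])
open import Data.Integer using (+_; -_; ∣_∣)
open import Data.Integer.Divisibility.Signed using (∣⇒∣ᵤ)

2^b∣2^a*m⇒b≤a : ∀ a b {m} → 2 ∤ m → 2 ^ b ∣ 2 ^ a * m → b ≤ a
2^b∣2^a*m⇒b≤a a       zero    2∤m _ = z≤n
2^b∣2^a*m⇒b≤a zero    (suc b) 2∤m 2^b∣m =
  contradiction (subst (2 ∣_) (ℕₚ.*-identityˡ _) (∣-trans (m∣m*n (2 ^ b)) 2^b∣m)) 2∤m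
2^b∣2^a*m⇒b≤a (suc a) (suc b) 2∤m 2^b∣2^a*m =
  s≤s (2^b∣2^a*m⇒b≤a a b 2∤m (*-cancelˡ-∣ 2 (subst (2 * 2 ^ b ∣_) (ℕₚ.*-assoc 2 (2 ^ a) _) 2^b∣2^a*m)))

2^b∣[2^a*m]²⇒b≤2a : ∀ a b {m} → 2 ∤ m → 2 ^ b ∣ (2 ^ a * m) * (2 ^ a * m) → b ≤ a + a
2^b∣[2^a*m]²⇒b≤2a a b {m} 2∤m 2^b∣P² = 2^b∣2^a*m⇒b≤a (a + a) b 2∤m*m (subst (2 ^ b ∣_) square 2^b∣P²)
  where
  2∤m*m : 2 ∤ m * m
  2∤m*m 2∣m*m = 2∤m (reduce (euclidsLemma m m prime[2] 2∣m*m))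
  interchange : ∀ x m → (x * m) * (x * m) ≡ (x * x) * (m * m)
  interchange = ℕ-solve-∀
  square : (2 ^ a * m) * (2 ^ a * m) ≡ 2 ^ (a + a) * (m * m)
  square = trans (interchange (2 ^ a) m) (cong (_* (m * m)) (sym (ℕₚ.^-distribˡ-+-* 2 a a)))

n≤1+2α⇒n/2≤α : ∀ {n α} → n ≤ suc (α + α) → n / 2 ≤ α
n≤1+2α⇒n/2≤α {n} {α} n≤ = ℕₚ.≤-pred (m<n*o⇒m/o<n (subst (suc n ≤_) (2+2α α) (s≤s n≤)))
  where
  2+2α : ∀ α → suc (suc (α + α)) ≡ suc α * 2
  2+2α = ℕ-solve-∀

corollary2 : (n : ℕ) (G : SimpleGraph n) → det (walkMatrix G) ≢ + 0 →
    (α m : ℕ) → 2 ∤ m → (det (walkMatrix G) ≡ + (2 ^ α * m) ⊎ det (walkMatrix G) ≡ - (+ (2 ^ α * m))) →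
    n / 2 ≤ α
corollary2 zero    G _ α m 2∤m det≡ = z≤n
corollary2 (suc n) G _ α m 2∤m det≡ = n≤1+2α⇒n/2≤α (s≤s (2^b∣[2^a*m]²⇒b≤2a α n 2∤m 2^n∣det²))
  where
  2^n∣det² : 2 ^ n ∣ (2 ^ α * m) * (2 ^ α * m)
  2^n∣det² = subst₂ (λ a b → ∣ a ∣ ∣ ∣ b ∣) (pos-^ 2 n) (±-square (2 ^ α * m) det≡)
                    (∣⇒∣ᵤ (walkMatrix-det²-divisible G))
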